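{- Let $a\in S_n$ and let $\sigma\in G_f$ satisfy $\sigma a=a\sigma$. Suppose $i_0\in\{1,\dots,n\}$ satisfies $\sigma(i_0)\neq i_0$, and suppose $\sigma(i_0)=a^{d}(i_0)$ for some integer $d>0$. Then there exist integers $d_0>0$ and $k>1$ such that the cycle of $a$ containing $i_0$ has length $kd_0$, and, writing $i_j=a^j(i_0)$ so that this cycle is $(i_0\,\cdots\,i_{d_0-1}\,i_{d_0}\,\cdots\,i_{kd_0-1})$, we have $f(i_{cd_0+t})=f(i_t)$ for all $t=0,1,\dots,d_0-1$ and $c=0,1,\dots,k-1$.
   Context: $f$ is an arbitrary map from $\{1,\dots,n\}$ to some set, $S_n$ is the symmetric group on $\{1,\dots,n\}$, and $G_f=\{\sigma\in S_n: f(\sigma(i))=f(i)\text{ for all }i\}$ (a subgroup of $S_n$). -}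

module Defs where

open import Data.Nat using (ℕ; zero; suc; _<_)
open import Data.Fin using (Fin)
open import Data.Fin.Permutation using (Permutation′; _⟨$⟩ʳ_)
open import Data.Product using (_×_)
open import Relation.Binary.PropositionalEquality using (_≡_; _≢_)

_^_⟨_⟩ : {n : ℕ} → Permutation′ n → ℕ → Fin n → Fin n
a ^ zero ⟨ i ⟩ = i
a ^ suc m ⟨ i ⟩ = a ⟨$⟩ʳ (a ^ m ⟨ i ⟩)

InGf : {n : ℕ} {X : Set} → (Fin n → X) → Permutation′ n → Set
InGf {n} f σ = (i : Fin n) → f (σ ⟨$⟩ʳ i) ≡ f i

Commute : {n : ℕ} → Permutation′ n → Permutation′ n → Set
Commute {n} σ a = (i : Fin n) → σ ⟨$⟩ʳ (a ⟨$⟩ʳ i) ≡ a ⟨$⟩ʳ (σ ⟨$⟩ʳ i)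

CycleLength : {n : ℕ} → Permutation′ n → Fin n → ℕ → Set
CycleLength a i m =
  (0 < m) × (a ^ m ⟨ i ⟩ ≡ i) × ((m′ : ℕ) → 0 < m′ → m′ < m → a ^ m′ ⟨ i ⟩ ≢ i)

{-# OPTIONS --safe #-}
-- The colouring F j = f (a^j i₀) along the cycle of i₀ has period L, the
-- cycle length, and also period d, because σ commutes with a and preserves
-- f, so F (j + d) = f (a^j (σ i₀)) = f (σ (a^j i₀)) = F j. Hence it has
-- period d₀ = gcd d L by Bézout, and d₀ is a proper divisor of L: were
-- it L, then L ∣ d and σ i₀ = a^d i₀ = i₀.
module Submission where

open import Defs
open import Data.Nat using (ℕ; _<_; _*_; _+_; zero; suc; _∸_; _<?_; >-nonZero)
open import Data.Nat.Properties
open import Data.Nat.Divisibility using (_∣_; divides; quotient; quotient>1)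
open import Data.Nat.GCD using (gcd; gcd-GCD; gcd[m,n]∣m; gcd[m,n]∣n; gcd[m,n]≤n; gcd[m,n]≢0; module Bézout)
open import Data.Nat.Induction using (<-rec)
open import Data.Fin using (Fin; toℕ)
open import Data.Fin.Properties using (pigeonhole) renaming (_≟_ to _≟ᶠ_)
open import Data.Fin.Permutation using (Permutation′; _⟨$⟩ʳ_; _⟨$⟩ˡ_; inverseˡ)
open import Data.Product using (_×_; ∃-syntax; _,_)
open import Data.Sum using (inj₂)
open import Function using (_∘_)
open import Relation.Nullary using (yes; no; ¬_)
open import Relation.Nullary.Decidable using (_×-dec_)
open import Relation.Unary using (Pred; Decidable)
open import Relation.Binary.PropositionalEquality

module _ {p} {P : Pred ℕ p} (P? : Decidable P) where

  least-witness : ∀ {m} → P m → ∃[ l ] (P l × (∀ {j} → j < l → ¬ P j))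
  least-witness {m} = <-rec (λ m → P m → ∃[ l ] (P l × (∀ {j} → j < l → ¬ P j))) step m
    where
    step : ∀ m → (∀ {j} → j < m → P j → ∃[ l ] (P l × (∀ {j} → j < l → ¬ P j)))
         → P m → ∃[ l ] (P l × (∀ {j} → j < l → ¬ P j))
    step m rec Pm with anyUpTo? P? m
    ... | yes (j , j<m , Pj) = rec j<m Pj
    ... | no ¬smaller        = m , Pm , λ j<m Pj → ¬smaller (_ , j<m , Pj)

module _ {A : Set} where

  Periodic : (ℕ → A) → ℕ → Set
  Periodic F p = ∀ j → F (j + p) ≡ F j

  periodic-* : ∀ {F p} → Periodic F p → ∀ m → Periodic F (m * p)
  periodic-* {F} {p} per zero    j = cong F (+-identityʳ j)
  periodic-* {F} {p} per (suc m) j = begin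
    F (j + (p + m * p)) ≡⟨ cong F (+-assoc j p (m * p)) ⟨
    F (j + p + m * p)   ≡⟨ periodic-* per m (j + p) ⟩
    F (j + p)           ≡⟨ per j ⟩
    F j                 ∎
    where open ≡-Reasoning

  periodic-∣ : ∀ {F p q} → Periodic F p → p ∣ q → Periodic F q
  periodic-∣ per (divides m refl) = periodic-* per m

  periodic-gcd : ∀ {F p q} → Periodic F p → Periodic F q → Periodic F (gcd p q)
  periodic-gcd {F} {p} {q} per-p per-q j with Bézout.identity (gcd-GCD p q)
  ... | Bézout.+- x y eq = begin
    F (j + gcd p q)           ≡⟨ periodic-* per-q y (j + gcd p q) ⟨
    F (j + gcd p q + y * q)   ≡⟨ cong F (trans (+-assoc j _ _) (cong (j +_) eq)) ⟩
    F (j + x * p)             ≡⟨ periodic-* per-p x j ⟩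
    F j                       ∎
    where open ≡-Reasoning
  ... | Bézout.-+ x y eq = begin
    F (j + gcd p q)           ≡⟨ periodic-* per-p x (j + gcd p q) ⟨
    F (j + gcd p q + x * p)   ≡⟨ cong F (trans (+-assoc j _ _) (cong (j +_) eq)) ⟩
    F (j + y * q)             ≡⟨ periodic-* per-q y j ⟩
    F j                       ∎
    where open ≡-Reasoning

module _ {n : ℕ} (a : Permutation′ n) where

  ^-+ : ∀ m k (x : Fin n) → a ^ (m + k) ⟨ x ⟩ ≡ a ^ m ⟨ a ^ k ⟨ x ⟩ ⟩
  ^-+ zero    k x = refl
  ^-+ (suc m) k x = cong (a ⟨$⟩ʳ_) (^-+ m k x)

  ^-injective : ∀ m {x y : Fin n} → a ^ m ⟨ x ⟩ ≡ a ^ m ⟨ y ⟩ → x ≡ y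
  ^-injective zero    eq = eq
  ^-injective (suc m) eq =
    ^-injective m (trans (sym (inverseˡ a)) (trans (cong (a ⟨$⟩ˡ_) eq) (inverseˡ a)))

  orbit-periodic : ∀ {m} (x : Fin n) → a ^ m ⟨ x ⟩ ≡ x → Periodic (λ j → a ^ j ⟨ x ⟩) m
  orbit-periodic {m} x a^mx≡x j = trans (^-+ j m x) (cong (a ^ j ⟨_⟩) a^mx≡x)

  orbit-returns : (x : Fin n) → ∃[ m ] (0 < m × a ^ m ⟨ x ⟩ ≡ x)
  orbit-returns x with pigeonhole (n<1+n n) (λ (j : Fin (suc n)) → a ^ toℕ j ⟨ x ⟩)
  ... | i , j , i<j , a^ix≡a^jx = toℕ j ∸ toℕ i , m<n⇒0<n∸m i<j , ^-injective (toℕ i) (begin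
    a ^ toℕ i ⟨ a ^ (toℕ j ∸ toℕ i) ⟨ x ⟩ ⟩ ≡⟨ ^-+ (toℕ i) _ x ⟨
    a ^ (toℕ i + (toℕ j ∸ toℕ i)) ⟨ x ⟩     ≡⟨ cong (a ^_⟨ x ⟩) (m+[n∸m]≡n (<⇒≤ i<j)) ⟩
    a ^ toℕ j ⟨ x ⟩                         ≡⟨ a^ix≡a^jx ⟨
    a ^ toℕ i ⟨ x ⟩                         ∎)
    where open ≡-Reasoning

  cycleLength-exists : (x : Fin n) → ∃[ L ] CycleLength a x L
  cycleLength-exists x with orbit-returns x
  ... | m , returns with least-witness (λ m → (0 <? m) ×-dec (a ^ m ⟨ x ⟩ ≟ᶠ x)) returns
  ... | L , (L>0 , a^Lx≡x) , smaller = L , L>0 , a^Lx≡x , λ m′ m′>0 m′<L eq → smaller m′<L (m′>0 , eq)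

commute-^ : ∀ {n} {σ a : Permutation′ n} → Commute σ a →
            ∀ j (x : Fin n) → σ ⟨$⟩ʳ (a ^ j ⟨ x ⟩) ≡ a ^ j ⟨ σ ⟨$⟩ʳ x ⟩
commute-^ σa≡aσ zero    x = refl
commute-^ {σ = σ} {a} σa≡aσ (suc j) x =
  trans (σa≡aσ _) (cong (a ⟨$⟩ʳ_) (commute-^ {σ = σ} {a} σa≡aσ j x))

InGf-orbit-periodic : ∀ {n} {X : Set} {f : Fin n → X} {a σ : Permutation′ n} →
  InGf f σ → Commute σ a → ∀ {x d} → σ ⟨$⟩ʳ x ≡ a ^ d ⟨ x ⟩ →
  Periodic (λ j → f (a ^ j ⟨ x ⟩)) d
InGf-orbit-periodic {f = f} {a} {σ} σ∈Gf σa≡aσ {x} {d} σx≡a^dx j = begin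
  f (a ^ (j + d) ⟨ x ⟩)     ≡⟨ cong f (^-+ a j d x) ⟩
  f (a ^ j ⟨ a ^ d ⟨ x ⟩ ⟩) ≡⟨ cong (λ y → f (a ^ j ⟨ y ⟩)) σx≡a^dx ⟨
  f (a ^ j ⟨ σ ⟨$⟩ʳ x ⟩)    ≡⟨ cong f (commute-^ {σ = σ} {a} σa≡aσ j x) ⟨
  f (σ ⟨$⟩ʳ (a ^ j ⟨ x ⟩))  ≡⟨ σ∈Gf _ ⟩
  f (a ^ j ⟨ x ⟩)           ∎
  where open ≡-Reasoning

lemma4p2 : (n : ℕ) (X : Set) (f : Fin n → X) (a σ : Permutation′ n)
    → InGf f σ → Commute σ a
    → (i₀ : Fin n) → σ ⟨$⟩ʳ i₀ ≢ i₀
    → (d : ℕ) → 0 < d → σ ⟨$⟩ʳ i₀ ≡ a ^ d ⟨ i₀ ⟩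
    → ∃[ d₀ ] ∃[ k ] (0 < d₀ × 1 < k × CycleLength a i₀ (k * d₀)
        × ((t c : ℕ) → t < d₀ → c < k
           → f (a ^ (c * d₀ + t) ⟨ i₀ ⟩) ≡ f (a ^ t ⟨ i₀ ⟩)))
lemma4p2 n X f a σ σ∈Gf σa≡aσ i₀ σi₀≢i₀ d _ σi₀≡a^di₀
  with cycleLength-exists a i₀
... | L , L>0 , a^Li₀≡i₀ , L-least =
  d₀ , quotient d₀∣L , d₀>0 , quotient>1 d₀∣L d₀<L ,
  subst (CycleLength a i₀) (_∣_.equality d₀∣L) (L>0 , a^Li₀≡i₀ , L-least) ,
  λ t c _ _ → trans (cong F (+-comm (c * d₀) t)) (periodic-* F-periodic c t)
  where
  instance _ = >-nonZero L>0
  d₀   = gcd d L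
  d₀∣L = gcd[m,n]∣n d L
  F : ℕ → X
  F j = f (a ^ j ⟨ i₀ ⟩)
  F-periodic : Periodic F d₀
  F-periodic = periodic-gcd {p = d} {L} (InGf-orbit-periodic {a = a} {σ} σ∈Gf σa≡aσ σi₀≡a^di₀)
                            (cong f ∘ orbit-periodic a i₀ a^Li₀≡i₀)
  d₀>0 : 0 < d₀
  d₀>0 = n≢0⇒n>0 (gcd[m,n]≢0 d L (inj₂ (>⇒≢ L>0)))
  d₀≢L : d₀ ≢ L
  d₀≢L d₀≡L = σi₀≢i₀ (trans σi₀≡a^di₀
    (periodic-∣ {p = L} (orbit-periodic a i₀ a^Li₀≡i₀) (subst (_∣ d) d₀≡L (gcd[m,n]∣m d L)) 0))
  d₀<L : d₀ < L
  d₀<L = ≤∧≢⇒< (gcd[m,n]≤n d L) d₀≢L
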